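{- For every $t\in\mathrm{CL}(\mathcal{B})$ and every variable $x$ we have $[x]_{S_{ -\eta}}t=[x]_{S'_{ -\eta}}t$ (syntactic identity).
   Context: Lambda-terms are considered up to $\alpha$-equivalence; $\mathrm{FV}(t)$ is the set of free variables of $t$. Fix the combinators $\mathsf{S}=\lambda xyz.xz(yz)$, $\mathsf{K}=\lambda xy.x$, $\mathsf{I}=\lambda x.x$, $\mathsf{B}=\lambda xyz.x(yz)$, $\mathsf{C}=\lambda xyz.xzy$, let $\mathcal{B}=\{\mathsf{S},\mathsf{K},\mathsf{I},\mathsf{B},\mathsf{C}\}$, and let $\mathrm{CL}(\mathcal{B})$ be the set of terms built from variables and elements of $\mathcal{B}$ using only application (left-associative); equality of such terms is syntactic, combinators treated as atoms. Algorithm $S_{ -\eta}$: for a variable $x$ and $t\in\mathrm{CL}(\mathcal{B})$, $[x]t:=[x]_{S_{ -\eta}}t$ is given by the first applicable equation: $[x]t=\mathsf{K}t$ if $x\notin\mathrm{FV}(t)$; $[x]x=\mathsf{I}$; $[x](st)=\mathsf{B}s([x]t)$ if $x\notin\mathrm{FV}(s)$; $[x](st)=\mathsf{C}([x]s)t$ if $x\notin\mathrm{FV}(t)$; $[x](st)=\mathsf{S}([x]s)([x]t)$. Algorithm $S'_{ -\eta}$: $[x](st)=\mathrm{Opt}(\mathsf{S}([x]s)([x]t))$; $[x]x=\mathsf{I}$; $[x]t=\mathsf{K}t$ otherwise (for $t$ a variable other than $x$ or a constant), earlier equations taking precedence, where $\mathrm{Opt}$ is given by the first applicable clause: $\mathrm{Opt}(\mathsf{S}(\mathsf{K}s)(\mathsf{K}t))=\mathsf{K}(st)$;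 $\mathrm{Opt}(\mathsf{S}(\mathsf{K}s)t)=\mathsf{B}st$; $\mathrm{Opt}(\mathsf{S}s(\mathsf{K}t))=\mathsf{C}st$; $\mathrm{Opt}(\mathsf{S}st)=\mathsf{S}st$. -}

module Defs where

open import Data.Nat using (ℕ; _≟_)
open import Data.Bool using (Bool; true; false; _∨_; not)
open import Relation.Nullary.Decidable using (⌊_⌋)

-- Combinators are atoms; equality is syntactic
-- (propositional equality _≡_ on this inductive type).
data CL : Set where
  var : ℕ → CL
  S K I B C : CL
  _·_ : CL → CL → CL

infixl 9 _·_

occurs : ℕ → CL → Bool
occurs x (var y) = ⌊ x ≟ y ⌋
occurs x S = false
occurs x K = false
occurs x I = false
occurs x B = false
occurs x C = false
occurs x (s · t) = occurs x s ∨ occurs x t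

absS : ℕ → CL → CL
absS x t with occurs x t
absS x t | false = K · t
absS x (var y) | true = I            -- only possible when y = x
absS x (s · t) | true with occurs x s | occurs x t
... | false | _ = B · s · absS x t
... | true | false = C · absS x s · t
... | true | true = S · absS x s · absS x t
absS x S | true = K · S              -- unreachable
absS x K | true = K · K              -- unreachable
absS x I | true = K · I              -- unreachable
absS x B | true = K · B              -- unreachable
absS x C | true = K · C              -- unreachable

-- Opt, applied to S s t (the arguments s, t of the S-redex), first applicable clause:
--   Opt(S (K s)(K t)) = K (s t)
--   Opt(S (K s) t)    = B s t
--   Opt(S s (K t))    = C s t
--   Opt(S s t)        = S s t
optSnd : CL → CL → CL          -- second clause onward, given left arg is not handled
optSnd s (K · t) = C · s · t
optSnd s t = S · s · t

opt : CL → CL → CL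
opt (K · s) (K · t) = K · (s · t)
opt (K · s) t = B · s · t
opt s t = optSnd s t

-- Opt as a function on terms (identity on terms not of the form S s t;
-- only ever applied to S s t in S'_{-η}).
Opt : CL → CL
Opt (S · s · t) = opt s t
Opt u = u

absS' : ℕ → CL → CL
absS' x (s · t) = Opt (S · absS' x s · absS' x t)
absS' x (var y) with ⌊ x ≟ y ⌋
... | true = I
... | false = K · var y
absS' x S = K · S
absS' x K = K · K
absS' x I = K · I
absS' x B = K · B
absS' x C = K · C

-- When x is not free in t, S'_{-η} also returns K t (the first Opt clause
-- collapses S (K s) (K t)).  When x is free in t, the result of S'_{-η} is
-- never of the form K v.  Hence, at an application s t, Opt selects its clause
-- exactly according to which of s, t contain x, which is the case distinction
-- S_{-η} makes, and the two algorithms agree by induction on t.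
module Submission where

open import Defs
open import Data.Nat using (ℕ; _≟_)
open import Data.Bool using (true; false)
open import Relation.Nullary using (yes; no; ¬_)
open import Relation.Binary.PropositionalEquality using (_≡_; refl; sym; trans; cong; cong₂; module ≡-Reasoning)

NotKApp : CL → Set
NotKApp u = ∀ v → ¬ (u ≡ K · v)

opt-Kˡ : ∀ s u → NotKApp u → opt (K · s) u ≡ B · s · u
opt-Kˡ s (var _) _ = refl
opt-Kˡ s S _ = refl
opt-Kˡ s K _ = refl
opt-Kˡ s I _ = refl
opt-Kˡ s B _ = refl
opt-Kˡ s C _ = refl
opt-Kˡ s (K · v) u≢Kv with () ← u≢Kv v refl
opt-Kˡ s (var _ · _) _ = refl
opt-Kˡ s (S · _) _ = refl
opt-Kˡ s (I · _) _ = refl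
opt-Kˡ s (B · _) _ = refl
opt-Kˡ s (C · _) _ = refl
opt-Kˡ s (_ · _ · _) _ = refl

opt≡optSnd : ∀ a u → NotKApp a → opt a u ≡ optSnd a u
opt≡optSnd (var _) u _ = refl
opt≡optSnd S u _ = refl
opt≡optSnd K u _ = refl
opt≡optSnd I u _ = refl
opt≡optSnd B u _ = refl
opt≡optSnd C u _ = refl
opt≡optSnd (K · v) u a≢Kv with () ← a≢Kv v refl
opt≡optSnd (var _ · _) u _ = refl
opt≡optSnd (S · _) u _ = refl
opt≡optSnd (I · _) u _ = refl
opt≡optSnd (B · _) u _ = refl
opt≡optSnd (C · _) u _ = refl
opt≡optSnd (_ · _ · _) u _ = refl

optSnd-S : ∀ a u → NotKApp u → optSnd a u ≡ S · a · u
optSnd-S a (var _) _ = refl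
optSnd-S a S _ = refl
optSnd-S a K _ = refl
optSnd-S a I _ = refl
optSnd-S a B _ = refl
optSnd-S a C _ = refl
optSnd-S a (K · v) u≢Kv with () ← u≢Kv v refl
optSnd-S a (var _ · _) _ = refl
optSnd-S a (S · _) _ = refl
optSnd-S a (I · _) _ = refl
optSnd-S a (B · _) _ = refl
optSnd-S a (C · _) _ = refl
optSnd-S a (_ · _ · _) _ = refl

opt-Kʳ : ∀ a t → NotKApp a → opt a (K · t) ≡ C · a · t
opt-Kʳ a t a≢K = opt≡optSnd a (K · t) a≢K

opt-S : ∀ a u → NotKApp a → NotKApp u → opt a u ≡ S · a · u
opt-S a u a≢K u≢K = trans (opt≡optSnd a u a≢K) (optSnd-S a u u≢K)

absS'-fresh : ∀ x t → occurs x t ≡ false → absS' x t ≡ K · t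
absS'-fresh x (var y) x∉t with x ≟ y
... | yes _ with () ← x∉t
... | no _ = refl
absS'-fresh x S _ = refl
absS'-fresh x K _ = refl
absS'-fresh x I _ = refl
absS'-fresh x B _ = refl
absS'-fresh x C _ = refl
absS'-fresh x (s · t) x∉st with occurs x s in x∉s | occurs x t in x∉t
... | false | false = cong₂ opt (absS'-fresh x s x∉s) (absS'-fresh x t x∉t)
... | true | _ with () ← x∉st
... | false | true with () ← x∉st

absS'-notKApp : ∀ x t → occurs x t ≡ true → NotKApp (absS' x t)
absS'-notKApp x (var y) x∈t v eq with x ≟ y
absS'-notKApp x (var y) () v eq | no _
absS'-notKApp x (var y) x∈t v () | yes _
absS'-notKApp x (s · t) x∈st v eq with occurs x s in x∈s | occurs x t in x∈t
... | false | false with () ← x∈st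
... | false | true
  rewrite absS'-fresh x s x∈s | opt-Kˡ s (absS' x t) (absS'-notKApp x t x∈t)
  with () ← eq
... | true | false
  rewrite absS'-fresh x t x∈t | opt-Kʳ (absS' x s) t (absS'-notKApp x s x∈s)
  with () ← eq
... | true | true
  rewrite opt-S (absS' x s) (absS' x t) (absS'-notKApp x s x∈s) (absS'-notKApp x t x∈t)
  with () ← eq

mainTheorem6 : (x : ℕ) (t : CL) → absS x t ≡ absS' x t
mainTheorem6 x (var y) with x ≟ y
... | yes _ = refl
... | no _ = refl
mainTheorem6 x S = refl
mainTheorem6 x K = refl
mainTheorem6 x I = refl
mainTheorem6 x B = refl
mainTheorem6 x C = refl
-- The with decides the test on occurs x (s · t); the rewrites then decide the
-- inner tests of absS on occurs x s and occurs x t, which only appear afterwards.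
mainTheorem6 x (s · t) with occurs x s in x∈s | occurs x t in x∈t
... | false | false = sym (cong₂ opt (absS'-fresh x s x∈s) (absS'-fresh x t x∈t))
... | false | true rewrite x∈s = begin
  B · s · absS x t              ≡⟨ cong (B · s ·_) (mainTheorem6 x t) ⟩
  B · s · absS' x t             ≡⟨ opt-Kˡ s (absS' x t) (absS'-notKApp x t x∈t) ⟨
  opt (K · s) (absS' x t)       ≡⟨ cong (λ a → opt a (absS' x t)) (absS'-fresh x s x∈s) ⟨
  opt (absS' x s) (absS' x t)   ∎
  where open ≡-Reasoning
... | true | false rewrite x∈s | x∈t = begin
  C · absS x s · t              ≡⟨ cong (λ a → C · a · t) (mainTheorem6 x s) ⟩
  C · absS' x s · t             ≡⟨ opt-Kʳ (absS' x s) t (absS'-notKApp x s x∈s) ⟨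
  opt (absS' x s) (K · t)       ≡⟨ cong (opt (absS' x s)) (absS'-fresh x t x∈t) ⟨
  opt (absS' x s) (absS' x t)   ∎
  where open ≡-Reasoning
... | true | true rewrite x∈s | x∈t = begin
  S · absS x s · absS x t       ≡⟨ cong₂ (λ a b → S · a · b) (mainTheorem6 x s) (mainTheorem6 x t) ⟩
  S · absS' x s · absS' x t     ≡⟨ opt-S (absS' x s) (absS' x t) (absS'-notKApp x s x∈s) (absS'-notKApp x t x∈t) ⟨
  opt (absS' x s) (absS' x t)   ∎
  where open ≡-Reasoning
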